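{- For every $K_5$-free finite simple graph $G$ on $n$ vertices, \[\tau_{B}(G) \le \frac{b(G)\,(n-b(G))}{2} + \frac{3\,(n-b(G))^2}{16}.\]
   Context: All graphs are finite, simple and undirected. $\tau_{B}(G)$ denotes the minimum size of a set of edges whose deletion from $G$ leaves a bipartite graph. $b(G)$ denotes the largest size of a vertex set $B \subseteq V(G)$ such that the induced subgraph $G[B]$ is bipartite. $K_5$-free means $G$ contains no complete subgraph on $5$ vertices. -}

module Defs where

open import Data.Nat using (ℕ; zero; suc; _+_)
open import Data.Fin using (Fin; zero; suc; _<?_)
open import Relation.Nullary.Decidable using (does)
open import Data.Bool using (Bool; true; false; _∧_)
open import Data.Product using (Σ; _×_; ∃)
open import Relation.Binary.PropositionalEquality using (_≡_; _≢_)
open import Relation.Nullary using (¬_)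
open import Function.Definitions using (Injective)

count : {n : ℕ} → (Fin n → Bool) → ℕ
count {zero}  p = 0
count {suc n} p = (if0 (p zero)) + count (λ i → p (suc i))
  where
  if0 : Bool → ℕ
  if0 true  = 1
  if0 false = 0

sumF : {n : ℕ} → (Fin n → ℕ) → ℕ
sumF {zero}  f = 0
sumF {suc n} f = f zero + sumF (λ i → f (suc i))

record Graph (n : ℕ) : Set where
  field
    adj   : Fin n → Fin n → Bool
    sym   : ∀ i j → adj i j ≡ adj j i
    irrefl : ∀ i → adj i i ≡ false
open Graph public

record EdgeSet {n : ℕ} (G : Graph n) : Set where
  field
    mem  : Fin n → Fin n → Bool
    msym : ∀ i j → mem i j ≡ mem j i
    sub  : ∀ i j → mem i j ≡ true → adj G i j ≡ true
open EdgeSet public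

-- number of edges in F (each unordered pair {i,j} counted once, via i < j)
edgeCount : {n : ℕ} {G : Graph n} → EdgeSet G → ℕ
edgeCount {n} F = sumF (λ i → count (λ j → does (i <? j) ∧ mem F i j))

BipartiteAfterDeleting : {n : ℕ} (G : Graph n) → EdgeSet G → Set
BipartiteAfterDeleting {n} G F =
  ∃ λ (c : Fin n → Bool) →
    ∀ i j → adj G i j ≡ true → mem F i j ≡ false → c i ≢ c j

InducedBipartite : {n : ℕ} (G : Graph n) → (Fin n → Bool) → Set
InducedBipartite {n} G B =
  ∃ λ (c : Fin n → Bool) →
    ∀ i j → B i ≡ true → B j ≡ true → adj G i j ≡ true → c i ≢ c j

K5Free : {n : ℕ} → Graph n → Set
K5Free {n} G =
  ¬ (∃ λ (f : Fin 5 → Fin n) → Injective _≡_ _≡_ f ×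
       (∀ a b → a ≢ b → adj G (f a) (f b) ≡ true))

module Submission where

-- Let B (|B| = b) induce a bipartite subgraph, properly
-- 2-coloured by c₀, and let R = V ∖ B, r = n − b.  Keeping c₀ on B, the
-- vertices of R are recoloured greedily, one at a time, each receiving the
-- colour that is rarer among its neighbours outside the part of R not yet
-- coloured; then at most half of the edges meeting R are monochromatic.
-- Deleting the set F of monochromatic edges leaves G bipartite, and since no
-- edge inside B is monochromatic,
--   |F| ≤ (e(R,B) + e(R)) / 2,   e(R,B) ≤ r·b,   e(R) ≤ 3r²/8,
-- the last being Turán's bound for the K₅-free graph G[R] (induction on the
-- clique size, splitting off a vertex of maximum degree).

open import Defs renaming (sym to adj-sym)
open import Data.Nat using (ℕ; zero; suc; _+_; _*_; _∸_; _≤_; z≤n; _≤?_)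
open import Data.Nat.Properties
  using ( ≤-refl; ≤-reflexive; ≤-trans; ≤-total; ≤-pred; ≰⇒≥; n≮0; m≤m+n; m≤n⇒∃[o]m+o≡n; m+n∸m≡n
        ; +-comm; +-identityʳ; +-mono-≤; +-monoˡ-≤; +-monoʳ-≤; +-cancelʳ-≤
        ; *-comm; *-identityˡ; *-zeroʳ; *-distribˡ-+; *-distribʳ-+; *-monoʳ-≤; *-cancelˡ-≤
        ; module ≤-Reasoning )
open import Data.Bool using (Bool; true; false; _∧_; not; if_then_else_)
open import Data.Bool.Properties using (∧-zeroʳ; ∧-identityʳ; ∧-conicalˡ; ∧-conicalʳ; ¬-not; not-involutive) renaming (_≟_ to _≟ᵇ_)
open import Data.Fin using (Fin; zero; suc; _<?_; _≟_)
open import Data.Fin.Properties using (<-cmp; <-asym; any?)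
open import Data.Product using (Σ; _×_; ∃; _,_)
open import Data.Sum using (_⊎_; inj₁; inj₂; [_,_]′)
open import Data.Unit using (⊤; tt)
open import Data.Empty using (⊥-elim)
open import Relation.Nullary using (¬_; yes; no)
open import Relation.Nullary.Decidable using (does; dec-true; dec-false)
open import Relation.Binary using (tri<; tri≈; tri>)
open import Relation.Binary.PropositionalEquality
  using (_≡_; _≢_; refl; sym; trans; cong; cong₂; subst; subst₂; module ≡-Reasoning)
open import Data.Nat.Solver using (module +-*-Solver)
open +-*-Solver using (solve; _:+_; _:*_; _:=_; con)

private
  variable
    n : ℕ

true≢false : true ≢ false
true≢false ()

sumF-cong : {f g : Fin n → ℕ} → (∀ i → f i ≡ g i) → sumF f ≡ sumF g
sumF-cong {zero}  e = refl
sumF-cong {suc n} e = cong₂ _+_ (e zero) (sumF-cong (λ i → e (suc i)))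

sumF-mono : {f g : Fin n → ℕ} → (∀ i → f i ≤ g i) → sumF f ≤ sumF g
sumF-mono {zero}  e = z≤n
sumF-mono {suc n} e = +-mono-≤ (e zero) (sumF-mono (λ i → e (suc i)))

sumF-zero : sumF {n} (λ _ → 0) ≡ 0
sumF-zero {zero}  = refl
sumF-zero {suc n} = sumF-zero {n}

sumF-+ : (f g : Fin n → ℕ) → sumF (λ i → f i + g i) ≡ sumF f + sumF g
sumF-+ {zero}  f g = refl
sumF-+ {suc n} f g = begin
  (f zero + g zero) + sumF (λ i → f (suc i) + g (suc i))
    ≡⟨ cong ((f zero + g zero) +_) (sumF-+ (λ i → f (suc i)) (λ i → g (suc i))) ⟩
  (f zero + g zero) + (F + G)
    ≡⟨ solve 4 (λ a b c d → (a :+ b) :+ (c :+ d) := (a :+ c) :+ (b :+ d)) refl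
               (f zero) (g zero) F G ⟩
  (f zero + F) + (g zero + G) ∎
  where
  open ≡-Reasoning
  F = sumF (λ i → f (suc i))
  G = sumF (λ i → g (suc i))

sumF-*ʳ : (f : Fin n → ℕ) (k : ℕ) → sumF (λ i → f i * k) ≡ sumF f * k
sumF-*ʳ {zero}  f k = refl
sumF-*ʳ {suc n} f k =
  trans (cong (f zero * k +_) (sumF-*ʳ (λ i → f (suc i)) k))
        (sym (*-distribʳ-+ k (f zero) _))

sumF-swap : {m : ℕ} (f : Fin n → Fin m → ℕ) →
  sumF (λ i → sumF (λ j → f i j)) ≡ sumF (λ j → sumF (λ i → f i j))
sumF-swap {zero}  {m} f = sym (sumF-zero {m})
sumF-swap {suc n}     f =
  trans (cong (sumF (f zero) +_) (sumF-swap (λ i j → f (suc i) j)))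
        (sym (sumF-+ (f zero) (λ j → sumF (λ i → f (suc i) j))))

VertexSet : ℕ → Set
VertexSet n = Fin n → Bool

indicator : Bool → ℕ
indicator b = if b then 1 else 0

ΣOn : VertexSet n → (Fin n → ℕ) → ℕ
ΣOn X f = sumF (λ u → if X u then f u else 0)

everything : VertexSet n
everything _ = true

∁ : VertexSet n → VertexSet n
∁ X u = not (X u)

_∩_ _∖_ : VertexSet n → VertexSet n → VertexSet n
(X ∩ P) u = X u ∧ P u
(X ∖ P) u = X u ∧ not (P u)

_─_ : VertexSet n → Fin n → VertexSet n
(X ─ v) u = X u ∧ not (does (u ≟ v))

ΣOn-cong : (X : VertexSet n) {f g : Fin n → ℕ} →
  (∀ u → X u ≡ true → f u ≡ g u) → ΣOn X f ≡ ΣOn X g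
ΣOn-cong X e = sumF-cong (λ u → pointwise (X u) (e u))
  where
  pointwise : ∀ b {x y} → (b ≡ true → x ≡ y) → (if b then x else 0) ≡ (if b then y else 0)
  pointwise true  h = h refl
  pointwise false h = refl

ΣOn-mono : (X : VertexSet n) {f g : Fin n → ℕ} →
  (∀ u → X u ≡ true → f u ≤ g u) → ΣOn X f ≤ ΣOn X g
ΣOn-mono X e = sumF-mono (λ u → pointwise (X u) (e u))
  where
  pointwise : ∀ b {x y} → (b ≡ true → x ≤ y) → (if b then x else 0) ≤ (if b then y else 0)
  pointwise true  h = h refl
  pointwise false h = z≤n

ΣOn-setCong : {X Y : VertexSet n} (f : Fin n → ℕ) → (∀ u → X u ≡ Y u) → ΣOn X f ≡ ΣOn Y f
ΣOn-setCong f e = sumF-cong (λ u → cong (λ b → if b then f u else 0) (e u))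

ΣOn-+ : (X : VertexSet n) (f g : Fin n → ℕ) →
  ΣOn X (λ u → f u + g u) ≡ ΣOn X f + ΣOn X g
ΣOn-+ {n} X f g = trans (sumF-cong (λ u → pointwise (X u))) (sumF-+ {n} _ _)
  where
  pointwise : ∀ b {x y} → (if b then x + y else 0) ≡ (if b then x else 0) + (if b then y else 0)
  pointwise true  = refl
  pointwise false = refl

ΣOn-zero : (X : VertexSet n) (f : Fin n → ℕ) → (∀ u → X u ≡ true → f u ≡ 0) → ΣOn X f ≡ 0
ΣOn-zero {n} X f e = trans (sumF-cong (λ u → pointwise (X u) (e u))) (sumF-zero {n})
  where
  pointwise : ∀ b {x} → (b ≡ true → x ≡ 0) → (if b then x else 0) ≡ 0
  pointwise true  h = h refl
  pointwise false h = refl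

ΣOn-empty : (X : VertexSet n) (f : Fin n → ℕ) → (∀ u → X u ≡ false) → ΣOn X f ≡ 0
ΣOn-empty X f empty = ΣOn-zero X f (λ u Xu → ⊥-elim (true≢false (trans (sym Xu) (empty u))))

ΣOn-split : (X P : VertexSet n) (f : Fin n → ℕ) → ΣOn X f ≡ ΣOn (X ∩ P) f + ΣOn (X ∖ P) f
ΣOn-split {n} X P f = trans (sumF-cong (λ u → pointwise (X u) (P u))) (sumF-+ {n} _ _)
  where
  pointwise : ∀ x p {y} → (if x then y else 0) ≡ (if x ∧ p then y else 0) + (if x ∧ not p then y else 0)
  pointwise true  true  = sym (+-identityʳ _)
  pointwise true  false = refl
  pointwise false p     = refl

ΣOn-swap : (X Y : VertexSet n) (h : Fin n → Fin n → ℕ) →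
  ΣOn X (λ u → ΣOn Y (h u)) ≡ ΣOn Y (λ w → ΣOn X (λ u → h u w))
ΣOn-swap {n} X Y h = begin
  sumF (λ u → if X u then sumF (λ w → if Y w then h u w else 0) else 0)
    ≡⟨ sumF-cong (λ u → if-sumF (X u)) ⟩
  sumF (λ u → sumF (λ w → if X u then (if Y w then h u w else 0) else 0))
    ≡⟨ sumF-swap {n} {n} _ ⟩
  sumF (λ w → sumF (λ u → if X u then (if Y w then h u w else 0) else 0))
    ≡⟨ sumF-cong (λ w → sumF-cong (λ u → if-comm (X u) (Y w))) ⟩
  sumF (λ w → sumF (λ u → if Y w then (if X u then h u w else 0) else 0))
    ≡⟨ sym (sumF-cong (λ w → if-sumF (Y w))) ⟩
  sumF (λ w → if Y w then sumF (λ u → if X u then h u w else 0) else 0) ∎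
  where
  open ≡-Reasoning
  if-sumF : ∀ b {g : Fin n → ℕ} → (if b then sumF g else 0) ≡ sumF (λ w → if b then g w else 0)
  if-sumF true  = refl
  if-sumF false = sym (sumF-zero {n})
  if-comm : ∀ a b {x} → (if a then (if b then x else 0) else 0) ≡ (if b then (if a then x else 0) else 0)
  if-comm true  b     = refl
  if-comm false true  = refl
  if-comm false false = refl

ΣOn-single : (v : Fin n) (f : Fin n → ℕ) → ΣOn (λ u → does (u ≟ v)) f ≡ f v
ΣOn-single {suc n} zero    f = trans (cong (f zero +_) (sumF-zero {n})) (+-identityʳ _)
ΣOn-single {suc n} (suc v) f = ΣOn-single v (λ u → f (suc u))

ΣOn-insert : (X Y : VertexSet n) (v : Fin n) (f : Fin n → ℕ) →
  X v ≡ false → Y v ≡ true → (∀ u → u ≢ v → X u ≡ Y u) →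
  ΣOn Y f ≡ ΣOn X f + f v
ΣOn-insert {n} X Y v f Xv Yv same = begin
  ΣOn Y f                                        ≡⟨ sumF-cong pointwise ⟩
  sumF (λ u → (if X u then f u else 0) + (if does (u ≟ v) then f u else 0))
                                                 ≡⟨ sumF-+ {n} _ _ ⟩
  ΣOn X f + ΣOn (λ u → does (u ≟ v)) f          ≡⟨ cong (ΣOn X f +_) (ΣOn-single v f) ⟩
  ΣOn X f + f v                                  ∎
  where
  open ≡-Reasoning
  pointwise : ∀ u → (if Y u then f u else 0) ≡ (if X u then f u else 0) + (if does (u ≟ v) then f u else 0)
  pointwise u with u ≟ v
  ... | yes refl rewrite Xv | Yv = refl
  ... | no u≢v   rewrite same u u≢v = sym (+-identityʳ _)

count-as-ΣOn : (X : VertexSet n) → count X ≡ ΣOn X (λ _ → 1)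
count-as-ΣOn {zero}  X = refl
count-as-ΣOn {suc n} X with X zero
... | true  = cong suc (count-as-ΣOn (λ i → X (suc i)))
... | false = count-as-ΣOn (λ i → X (suc i))

count-cong : {X Y : VertexSet n} → (∀ u → X u ≡ Y u) → count X ≡ count Y
count-cong {X = X} {Y} e =
  trans (count-as-ΣOn X) (trans (ΣOn-setCong (λ _ → 1) e) (sym (count-as-ΣOn Y)))

count-split : (X P : VertexSet n) → count X ≡ count (X ∩ P) + count (X ∖ P)
count-split X P = begin
  count X                                                   ≡⟨ count-as-ΣOn X ⟩
  ΣOn X (λ _ → 1)                                           ≡⟨ ΣOn-split X P _ ⟩
  ΣOn (X ∩ P) (λ _ → 1) + ΣOn (X ∖ P) (λ _ → 1)             ≡⟨ sym (cong₂ _+_ (count-as-ΣOn (X ∩ P)) (count-as-ΣOn (X ∖ P))) ⟩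
  count (X ∩ P) + count (X ∖ P)                             ∎
  where open ≡-Reasoning

count-everything : count (everything {n}) ≡ n
count-everything {zero}  = refl
count-everything {suc n} = cong suc (count-everything {n})

count-complement : (X : VertexSet n) → count X + count (∁ X) ≡ n
count-complement {n} X = trans (sym (count-split everything X)) (count-everything {n})

count-∁∁ : (X : VertexSet n) → count (∁ (∁ X)) ≡ count X
count-∁∁ X = count-cong (λ u → not-involutive (X u))

ΣOn-const : (X : VertexSet n) (k : ℕ) → ΣOn X (λ _ → k) ≡ count X * k
ΣOn-const {n} X k = begin
  ΣOn X (λ _ → k)                       ≡⟨ sumF-cong (λ u → pointwise (X u)) ⟩
  sumF (λ u → indicator (X u) * k)      ≡⟨ sumF-*ʳ {n} _ k ⟩
  ΣOn X (λ _ → 1) * k                   ≡⟨ cong (_* k) (sym (count-as-ΣOn X)) ⟩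
  count X * k                           ∎
  where
  open ≡-Reasoning
  pointwise : ∀ b → (if b then k else 0) ≡ indicator b * k
  pointwise true  = sym (*-identityˡ k)
  pointwise false = refl

module Removal (S : VertexSet n) (v : Fin n) (Sv : S v ≡ true) where

  removed : (S ─ v) v ≡ false
  removed = trans (cong (λ b → S v ∧ not b) (dec-true (v ≟ v) refl)) (∧-zeroʳ (S v))

  kept : ∀ u → u ≢ v → (S ─ v) u ≡ S u
  kept u u≢v = trans (cong (λ b → S u ∧ not b) (dec-false (u ≟ v) u≢v)) (∧-identityʳ (S u))

  count-remove : count S ≡ suc (count (S ─ v))
  count-remove = begin
    count S                            ≡⟨ count-as-ΣOn S ⟩
    ΣOn S (λ _ → 1)                    ≡⟨ ΣOn-insert (S ─ v) S v _ removed Sv kept ⟩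
    ΣOn (S ─ v) (λ _ → 1) + 1          ≡⟨ cong (_+ 1) (sym (count-as-ΣOn (S ─ v))) ⟩
    count (S ─ v) + 1                  ≡⟨ +-comm (count (S ─ v)) 1 ⟩
    suc (count (S ─ v))                ∎
    where open ≡-Reasoning

Weight : ℕ → Set
Weight n = Fin n → Fin n → ℕ

Symmetric : Weight n → Set
Symmetric h = ∀ u w → h u w ≡ h w u

PairSum : Weight n → VertexSet n → VertexSet n → ℕ
PairSum h X Y = ΣOn X (λ u → ΣOn Y (h u))

PairSum-splitʳ : (h : Weight n) (X Y P : VertexSet n) →
  PairSum h X Y ≡ PairSum h X (Y ∩ P) + PairSum h X (Y ∖ P)
PairSum-splitʳ h X Y P =
  trans (ΣOn-cong X (λ u _ → ΣOn-split Y P (h u))) (ΣOn-+ X _ _)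

PairSum-swap : (h : Weight n) → Symmetric h → (X Y : VertexSet n) →
  PairSum h X Y ≡ PairSum h Y X
PairSum-swap h h-sym X Y =
  trans (ΣOn-swap X Y h) (ΣOn-cong Y (λ w _ → ΣOn-cong X (λ u _ → h-sym u w)))

PairSum-insertˡ : (h : Weight n) (X Y Z : VertexSet n) (v : Fin n) →
  X v ≡ false → Y v ≡ true → (∀ u → u ≢ v → X u ≡ Y u) →
  PairSum h Y Z ≡ PairSum h X Z + ΣOn Z (h v)
PairSum-insertˡ h X Y Z v = ΣOn-insert X Y v (λ u → ΣOn Z (h u))

PairSum-insertʳ : (h : Weight n) → Symmetric h → (X Y Z : VertexSet n) (v : Fin n) →
  X v ≡ false → Y v ≡ true → (∀ u → u ≢ v → X u ≡ Y u) →
  PairSum h Z Y ≡ PairSum h Z X + ΣOn Z (h v)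
PairSum-insertʳ h h-sym X Y Z v Xv Yv same = begin
  PairSum h Z Y                             ≡⟨ ΣOn-cong Z (λ u _ → ΣOn-insert X Y v (h u) Xv Yv same) ⟩
  ΣOn Z (λ u → ΣOn X (h u) + h u v)         ≡⟨ ΣOn-+ Z _ _ ⟩
  PairSum h Z X + ΣOn Z (λ u → h u v)       ≡⟨ cong (PairSum h Z X +_) (ΣOn-cong Z (λ u _ → h-sym u v)) ⟩
  PairSum h Z X + ΣOn Z (h v)               ∎
  where open ≡-Reasoning

-- Meeting h S is twice the total weight of the unordered pairs meeting S:
-- pairs inside S are counted twice by PairSum h S S, pairs leaving S once.
Meeting : Weight n → VertexSet n → ℕ
Meeting h S = 2 * PairSum h S (∁ S) + PairSum h S S

-- Every pair either meets S or lies inside its complement.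
PairSum-everything : (h : Weight n) → Symmetric h → (S : VertexSet n) →
  PairSum h everything everything ≡ Meeting h S + PairSum h (∁ S) (∁ S)
PairSum-everything h h-sym S = begin
  PairSum h everything everything
    ≡⟨ ΣOn-split everything S _ ⟩
  PairSum h S everything + PairSum h (∁ S) everything
    ≡⟨ cong₂ _+_ (PairSum-splitʳ h S everything S) (PairSum-splitʳ h (∁ S) everything S) ⟩
  (PairSum h S S + PairSum h S (∁ S)) + (PairSum h (∁ S) S + PairSum h (∁ S) (∁ S))
    ≡⟨ cong (λ x → (PairSum h S S + PairSum h S (∁ S)) + (x + PairSum h (∁ S) (∁ S)))
            (PairSum-swap h h-sym (∁ S) S) ⟩
  (PairSum h S S + PairSum h S (∁ S)) + (PairSum h S (∁ S) + PairSum h (∁ S) (∁ S))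
    ≡⟨ solve 3 (λ i x o → (i :+ x) :+ (x :+ o) := (con 2 :* x :+ i) :+ o) refl
               (PairSum h S S) (PairSum h S (∁ S)) (PairSum h (∁ S) (∁ S)) ⟩
  Meeting h S + PairSum h (∁ S) (∁ S) ∎
  where open ≡-Reasoning

Meeting-remove : (h : Weight n) → Symmetric h → (∀ u → h u u ≡ 0) →
  (S : VertexSet n) (v : Fin n) → S v ≡ true →
  Meeting h S ≡ Meeting h (S ─ v) + 2 * ΣOn (∁ S) (h v)
Meeting-remove h h-sym h-diag S v Sv = begin
  2 * PairSum h S (∁ S) + PairSum h S S
    ≡⟨ cong₂ (λ x y → 2 * x + y) (PairSum-insertˡ h S′ S (∁ S) v removed Sv kept) inside ⟩
  2 * (a + d) + ((e + t) + (t + 0))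
    ≡⟨ solve 4 (λ a d e t → con 2 :* (a :+ d) :+ ((e :+ t) :+ (t :+ con 0))
                          := (con 2 :* (a :+ t) :+ e) :+ con 2 :* d) refl a d e t ⟩
  (2 * (a + t) + e) + 2 * d
    ≡⟨ cong (λ x → (2 * x + e) + 2 * d) (sym leaving) ⟩
  Meeting h S′ + 2 * d ∎
  where
  open ≡-Reasoning
  open Removal S v Sv
  S′ = S ─ v
  a = PairSum h S′ (∁ S)
  d = ΣOn (∁ S) (h v)
  e = PairSum h S′ S′
  t = ΣOn S′ (h v)
  inside : PairSum h S S ≡ (e + t) + (t + 0)
  inside = trans (PairSum-insertˡ h S′ S S v removed Sv kept)
                 (cong₂ _+_ (PairSum-insertʳ h h-sym S′ S S′ v removed Sv kept)
                            (trans (ΣOn-insert S′ S v (h v) removed Sv kept) (cong (t +_) (h-diag v))))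
  leaving : PairSum h S′ (∁ S′) ≡ a + t
  leaving = PairSum-insertʳ h h-sym (∁ S) (∁ S′) S′ v (cong not Sv) (cong not removed)
                            (λ u u≢v → cong not (sym (kept u u≢v)))

-- Splitting S by P into A = S ∩ P and B = S ∖ P: an ordered pair inside S
-- lies inside A or has an end in B, so P(S,S) ≤ P(A,A) + 2·P(B,S).
PairSum-inside≤ : (h : Weight n) → Symmetric h → (S P : VertexSet n) →
  PairSum h S S ≤ PairSum h (S ∩ P) (S ∩ P) + 2 * PairSum h (S ∖ P) S
PairSum-inside≤ h h-sym S P = begin
  PairSum h S S                                  ≡⟨ ΣOn-split S P _ ⟩
  PairSum h A S + PairSum h B S                  ≡⟨ cong (_+ PairSum h B S) (PairSum-splitʳ h A S P) ⟩
  (PairSum h A A + PairSum h A B) + PairSum h B S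
    ≡⟨ cong (λ x → (PairSum h A A + x) + PairSum h B S) (PairSum-swap h h-sym A B) ⟩
  (PairSum h A A + PairSum h B A) + PairSum h B S
    ≤⟨ +-monoˡ-≤ (PairSum h B S) (+-monoʳ-≤ (PairSum h A A) B→A≤B→S) ⟩
  (PairSum h A A + PairSum h B S) + PairSum h B S
    ≡⟨ solve 2 (λ a b → (a :+ b) :+ b := a :+ con 2 :* b) refl (PairSum h A A) (PairSum h B S) ⟩
  PairSum h A A + 2 * PairSum h B S              ∎
  where
  open ≤-Reasoning
  A = S ∩ P
  B = S ∖ P
  B→A≤B→S : PairSum h B A ≤ PairSum h B S
  B→A≤B→S = ≤-trans (m≤m+n _ _) (≤-reflexive (sym (PairSum-splitʳ h B S P)))

Meeting-empty : (h : Weight n) (S : VertexSet n) → (∀ u → S u ≡ false) → Meeting h S ≡ 0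
Meeting-empty h S empty = cong₂ (λ x y → 2 * x + y) (ΣOn-empty S _ empty) (ΣOn-empty S _ empty)

handshake : (P : Fin n → Fin n → Bool) → (∀ i j → P i j ≡ P j i) → (∀ i → P i i ≡ false) →
  2 * sumF (λ i → count (λ j → does (i <? j) ∧ P i j))
    ≡ PairSum (λ i j → indicator (P i j)) everything everything
handshake {n} P P-sym P-irrefl = sym (begin
  sumF (λ i → sumF (λ j → indicator (P i j)))
    ≡⟨ sumF-cong (λ i → trans (sumF-cong (by-order i)) (sumF-+ {n} _ _)) ⟩
  sumF (λ i → upward i + downward i)  ≡⟨ sumF-+ {n} upward downward ⟩
  sumF upward + sumF downward         ≡⟨ cong (sumF upward +_) downward≡upward ⟩
  sumF upward + sumF upward           ≡⟨ cong (sumF upward +_) (sym (+-identityʳ _)) ⟩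
  2 * sumF upward                     ≡⟨ cong (2 *_) (sumF-cong (λ i → sym (count-as-ΣOn (λ j → does (i <? j) ∧ P i j)))) ⟩
  2 * sumF (λ i → count (λ j → does (i <? j) ∧ P i j)) ∎)
  where
  open ≡-Reasoning
  upward downward : Fin n → ℕ
  upward   i = sumF (λ j → indicator (does (i <? j) ∧ P i j))
  downward i = sumF (λ j → indicator (does (j <? i) ∧ P i j))
  by-order : ∀ i j → indicator (P i j) ≡ indicator (does (i <? j) ∧ P i j) + indicator (does (j <? i) ∧ P i j)
  by-order i j with <-cmp i j
  ... | tri< i<j _ _ rewrite dec-true (i <? j) i<j | dec-false (j <? i) (<-asym i<j) = sym (+-identityʳ _)
  ... | tri> _ _ j<i rewrite dec-false (i <? j) (<-asym j<i) | dec-true (j <? i) j<i = refl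
  ... | tri≈ _ refl _ rewrite P-irrefl i | ∧-zeroʳ (does (i <? i)) = refl
  downward≡upward : sumF downward ≡ sumF upward
  downward≡upward = trans (sumF-swap {n} {n} (λ i j → indicator (does (j <? i) ∧ P i j)))
    (sumF-cong (λ i → sumF-cong (λ j → cong (λ z → indicator (does (i <? j) ∧ z)) (P-sym j i))))

smaller-half : ∀ a b → 2 * a ≤ a + b ⊎ 2 * b ≤ a + b
smaller-half a b with a ≤? b
... | yes a≤b = inj₁ (≤-trans (≤-reflexive (cong (a +_) (+-identityʳ a))) (+-monoʳ-≤ a a≤b))
... | no  a≰b = inj₂ (≤-trans (≤-reflexive (cong (b +_) (+-identityʳ b))) (+-monoˡ-≤ b (≰⇒≥ a≰b)))

maximum-on : (S : VertexSet n) (f : Fin n → ℕ) →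
  (∀ u → S u ≡ false) ⊎ (∃ λ v → S v ≡ true × (∀ u → S u ≡ true → f u ≤ f v))
maximum-on {zero}  S f = inj₁ (λ ())
maximum-on {suc n} S f with maximum-on (λ u → S (suc u)) (λ u → f (suc u)) | S zero in S0
... | inj₁ empty | false = inj₁ λ { zero → S0 ; (suc u) → empty u }
... | inj₁ empty | true  = inj₂ (zero , S0 , λ { zero _ → ≤-refl
                                                ; (suc u) Su → ⊥-elim (true≢false (trans (sym Su) (empty u))) })
... | inj₂ (v , Sv , max) | false = inj₂ (suc v , Sv , λ { zero S0′ → ⊥-elim (true≢false (trans (sym S0′) S0))
                                                         ; (suc u) Su → max u Su })
... | inj₂ (v , Sv , max) | true with f (suc v) ≤? f zero
...   | yes fv≤f0 = inj₂ (zero , S0 , λ { zero _ → ≤-refl ; (suc u) Su → ≤-trans (max u Su) fv≤f0 })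
...   | no  fv≰f0 = inj₂ (suc v , Sv , λ { zero _ → ≰⇒≥ fv≰f0 ; (suc u) Su → max u Su })

-- 2xy ≤ x² + y², first for x ≤ y (write y = x + d: 2x(x + d) + d² = x² + (x + d)²)
twice-product≤squares-ordered : ∀ {x y} → x ≤ y → 2 * (x * y) ≤ x * x + y * y
twice-product≤squares-ordered {x} x≤y with m≤n⇒∃[o]m+o≡n x≤y
... | d , refl = ≤-trans (m≤m+n _ (d * d)) (≤-reflexive
      (solve 2 (λ x d → con 2 :* (x :* (x :+ d)) :+ d :* d := x :* x :+ (x :+ d) :* (x :+ d)) refl x d))

twice-product≤squares : ∀ x y → 2 * (x * y) ≤ x * x + y * y
twice-product≤squares x y with ≤-total x y
... | inj₁ x≤y = twice-product≤squares-ordered x≤y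
... | inj₂ y≤x = subst₂ _≤_ (cong (2 *_) (*-comm y x)) (+-comm (y * y) (x * x))
                        (twice-product≤squares-ordered y≤x)

-- The arithmetic of the Turán induction step: if the neighbourhood A of a
-- maximum-degree vertex (|A| = D) satisfies the bound for q, and the t
-- vertices outside A carry pairs of total weight at most 2tD, the bound for
-- q + 1 holds on all D + t vertices.  It rests on (D − (1+q)t)² ≥ 0.
turán-step-arithmetic : ∀ q E-A E t D → (1 + q) * E-A ≤ q * (D * D) → E ≤ E-A + 2 * (t * D) →
  (2 + q) * E ≤ (1 + q) * ((D + t) * (D + t))
turán-step-arithmetic q E-A E t D ih E≤ = *-cancelˡ-≤ (suc q) (begin
  (1 + q) * ((2 + q) * E)
    ≤⟨ *-monoʳ-≤ (1 + q) (*-monoʳ-≤ (2 + q) E≤) ⟩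
  (1 + q) * ((2 + q) * (E-A + 2 * (t * D)))
    ≡⟨ solve 4 (λ q E-A t D →
         (con 1 :+ q) :* ((con 2 :+ q) :* (E-A :+ con 2 :* (t :* D)))
         := (con 2 :+ q) :* ((con 1 :+ q) :* E-A) :+ (con 2 :+ q) :* ((con 1 :+ q) :* (con 2 :* (t :* D))))
       refl q E-A t D ⟩
  (2 + q) * ((1 + q) * E-A) + (2 + q) * ((1 + q) * (2 * (t * D)))
    ≤⟨ +-monoˡ-≤ _ (*-monoʳ-≤ (2 + q) ih) ⟩
  L
    ≤⟨ +-cancelʳ-≤ (2 * (x * D)) L R (begin
         L + 2 * (x * D)       ≤⟨ +-monoʳ-≤ L (twice-product≤squares x D) ⟩
         L + (x * x + D * D)   ≡⟨ square-completion ⟩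
         R + 2 * (x * D)       ∎) ⟩
  R ∎)
  where
  open ≤-Reasoning
  x = (1 + q) * t
  L = (2 + q) * (q * (D * D)) + (2 + q) * ((1 + q) * (2 * (t * D)))
  R = (1 + q) * ((1 + q) * ((D + t) * (D + t)))
  square-completion : L + (x * x + D * D) ≡ R + 2 * (x * D)
  square-completion = solve 3 (λ q t D →
     (con 2 :+ q) :* (q :* (D :* D)) :+ (con 2 :+ q) :* ((con 1 :+ q) :* (con 2 :* (t :* D)))
       :+ (((con 1 :+ q) :* t) :* ((con 1 :+ q) :* t) :+ D :* D)
     := (con 1 :+ q) :* ((con 1 :+ q) :* ((D :+ t) :* (D :+ t))) :+ con 2 :* (((con 1 :+ q) :* t) :* D))
     refl q t D

_[_≔_] : (Fin n → Bool) → Fin n → Bool → Fin n → Bool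
(c [ v ≔ x ]) u = if does (u ≟ v) then x else c u

update-at : (c : Fin n → Bool) (v : Fin n) (x : Bool) → (c [ v ≔ x ]) v ≡ x
update-at c v x = cong (λ b → if b then x else c v) (dec-true (v ≟ v) refl)

update-off : (c : Fin n → Bool) {v u : Fin n} {x : Bool} → u ≢ v → (c [ v ≔ x ]) u ≡ c u
update-off c {v} {u} {x} u≢v = cong (λ b → if b then x else c u) (dec-false (u ≟ v) u≢v)

module _ (G : Graph n) where

  edge : Weight n
  edge u w = indicator (adj G u w)

  edge-sym : Symmetric edge
  edge-sym u w = cong indicator (adj-sym G u w)

  edge-diag : ∀ u → edge u u ≡ 0
  edge-diag u = cong indicator (irrefl G u)

  edge≤1 : ∀ u w → edge u w ≤ 1
  edge≤1 u w with adj G u w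
  ... | true  = ≤-refl
  ... | false = z≤n

  neighbours : Fin n → VertexSet n
  neighbours v = adj G v

  -- Clique p S: S contains p pairwise adjacent vertices, given as a vertex v
  -- of S followed by a clique of size p − 1 inside S ∩ N(v).
  Clique : ℕ → VertexSet n → Set
  Clique zero    S = ⊤
  Clique (suc p) S = Σ (Fin n) λ v → S v ≡ true × Clique p (S ∩ neighbours v)

  clique-vertices : ∀ p S → Clique p S → ∃ λ (f : Fin p → Fin n) →
    (∀ a → S (f a) ≡ true) × (∀ a b → a ≢ b → adj G (f a) (f b) ≡ true)
  clique-vertices zero    S _ = (λ ()) , (λ ()) , (λ ())
  clique-vertices (suc p) S (v , Sv , K) with clique-vertices p (S ∩ neighbours v) K
  ... | g , in-S∩N , adjacent = f , in-S , pairwise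
    where
    f : Fin (suc p) → Fin n
    f zero    = v
    f (suc a) = g a
    in-S : ∀ a → S (f a) ≡ true
    in-S zero    = Sv
    in-S (suc a) = ∧-conicalˡ _ _ (in-S∩N a)
    pairwise : ∀ a b → a ≢ b → adj G (f a) (f b) ≡ true
    pairwise zero    zero    a≢b = ⊥-elim (a≢b refl)
    pairwise zero    (suc b) _   = ∧-conicalʳ _ _ (in-S∩N b)
    pairwise (suc a) zero    _   = trans (adj-sym G (g a) v) (∧-conicalʳ _ _ (in-S∩N a))
    pairwise (suc a) (suc b) a≢b = adjacent a b (λ a≡b → a≢b (cong suc a≡b))

  no-clique₅ : K5Free G → ∀ S → ¬ Clique 5 S
  no-clique₅ k5-free S K with clique-vertices 5 S K
  ... | f , _ , adjacent = k5-free (f , injective , adjacent)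
    where
    -- distinct vertices of a clique are adjacent, hence different
    injective : ∀ {a b} → f a ≡ f b → a ≡ b
    injective {a} {b} fa≡fb with a ≟ b
    ... | yes a≡b = a≡b
    ... | no  a≢b = ⊥-elim (true≢false
          (trans (sym (adjacent a b a≢b)) (trans (cong (λ x → adj G x (f b)) fa≡fb) (irrefl G (f b)))))

  -- For q = 0, S is independent.  Otherwise take v
  -- of maximum degree Δ in G[S]: A = S ∩ N(v) has no clique on q + 1
  -- vertices, and the t vertices of B = S ∖ N(v) meet at most tΔ edges.
  turán : ∀ q S → ¬ Clique (2 + q) S → (1 + q) * PairSum edge S S ≤ q * (count S * count S)
  turán zero S no-edge = ≤-reflexive (trans (+-identityʳ _)
    (ΣOn-zero S _ (λ u Su → ΣOn-zero S _ (λ w Sw → no-edge-between u w Su Sw))))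
    where
    no-edge-between : ∀ u w → S u ≡ true → S w ≡ true → edge u w ≡ 0
    no-edge-between u w Su Sw with adj G u w in uw
    ... | false = refl
    ... | true  = ⊥-elim (no-edge (u , Su , w , cong₂ _∧_ Sw uw , tt))
  turán (suc q) S no-clique with maximum-on S (λ u → ΣOn S (edge u))
  ... | inj₁ empty = ≤-trans (≤-reflexive (trans (cong ((2 + q) *_) (ΣOn-empty S _ empty)) (*-zeroʳ (2 + q)))) z≤n
  ... | inj₂ (v , Sv , max-degree) =
      subst (λ s → (2 + q) * PairSum edge S S ≤ (1 + q) * (s * s)) (sym (count-split S (neighbours v)))
        (turán-step-arithmetic q (PairSum edge A A) (PairSum edge S S) t Δ
          (turán q A (λ K → no-clique (v , Sv , K))) pairs-in-S)
    where
    A = S ∩ neighbours v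
    B = S ∖ neighbours v
    Δ = count A
    t = count B
    degree-v : ΣOn S (edge v) ≡ Δ
    degree-v = trans (sumF-cong (λ u → pointwise (S u) (adj G v u))) (sym (count-as-ΣOn A))
      where
      pointwise : ∀ a b → (if a then indicator b else 0) ≡ (if a ∧ b then 1 else 0)
      pointwise true  b = refl
      pointwise false b = refl
    -- every vertex of B has degree at most Δ in S
    from-B : PairSum edge B S ≤ t * Δ
    from-B = ≤-trans (ΣOn-mono B (λ u Bu → ≤-trans (max-degree u (∧-conicalˡ _ _ Bu)) (≤-reflexive degree-v)))
                     (≤-reflexive (ΣOn-const B Δ))
    pairs-in-S : PairSum edge S S ≤ PairSum edge A A + 2 * (t * Δ)
    pairs-in-S = ≤-trans (PairSum-inside≤ edge edge-sym S (neighbours v))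
                         (+-monoʳ-≤ (PairSum edge A A) (*-monoʳ-≤ 2 from-B))

  ProperOn : (Fin n → Bool) → VertexSet n → Set
  ProperOn c X = ∀ u w → X u ≡ true → X w ≡ true → adj G u w ≡ true → c u ≢ c w

  sameColour : (Fin n → Bool) → Fin n → Fin n → Bool
  sameColour c u w = does (c u ≟ᵇ c w)

  sameColour-sym : ∀ c u w → sameColour c u w ≡ sameColour c w u
  sameColour-sym c u w with c u | c w
  ... | true  | true  = refl
  ... | true  | false = refl
  ... | false | true  = refl
  ... | false | false = refl

  monochromatic : (Fin n → Bool) → Weight n
  monochromatic c u w = indicator (adj G u w ∧ sameColour c u w)

  monochromatic-sym : ∀ c → Symmetric (monochromatic c)
  monochromatic-sym c u w = cong indicator (cong₂ _∧_ (adj-sym G u w) (sameColour-sym c u w))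

  monochromatic-diag : ∀ c u → monochromatic c u u ≡ 0
  monochromatic-diag c u = cong (λ b → indicator (b ∧ sameColour c u u)) (irrefl G u)

  rarer-colour : (c : Fin n → Bool) (T : VertexSet n) (v : Fin n) →
    ∃ λ x → 2 * ΣOn T (λ w → indicator (adj G v w ∧ does (x ≟ᵇ c w))) ≤ ΣOn T (edge v)
  rarer-colour c T v =
    [ (λ half → true  , ≤-trans half (≤-reflexive by-colour))
    , (λ half → false , ≤-trans half (≤-reflexive by-colour))
    ]′ (smaller-half (coloured true) (coloured false))
    where
    coloured : Bool → ℕ
    coloured x = ΣOn T (λ w → indicator (adj G v w ∧ does (x ≟ᵇ c w)))
    by-colour : coloured true + coloured false ≡ ΣOn T (edge v)
    by-colour = sym (trans (ΣOn-cong T (λ w _ → pointwise (adj G v w) (c w))) (ΣOn-+ T _ _))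
      where
      pointwise : ∀ a y → indicator a ≡ indicator (a ∧ does (true ≟ᵇ y)) + indicator (a ∧ does (false ≟ᵇ y))
      pointwise true  true  = refl
      pointwise true  false = refl
      pointwise false y     = refl

  HalfRecolouring : VertexSet n → (Fin n → Bool) → Set
  HalfRecolouring S c₀ = ∃ λ c → (∀ u → S u ≡ false → c u ≡ c₀ u) ×
    2 * Meeting (monochromatic c) S ≤ Meeting edge S

  -- Greedy step: give v the colour rarer among its neighbours outside S,
  -- then recolour S ─ v; the edges from v to the outside of S are the only
  -- edges meeting S but not S ─ v, and at most half of them are monochromatic.
  recolour-step : ∀ S v → S v ≡ true → (∀ c₀ → HalfRecolouring (S ─ v) c₀) →
    ∀ c₀ → HalfRecolouring S c₀
  recolour-step S v Sv recolour-rest c₀ with rarer-colour c₀ (∁ S) v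
  ... | x , x-rare with recolour-rest (c₀ [ v ≔ x ])
  ...   | c , c-agrees , c-half = c , agrees , half
    where
    open Removal S v Sv
    agrees : ∀ u → S u ≡ false → c u ≡ c₀ u
    agrees u Su = trans (c-agrees u (trans (kept u u≢v) Su)) (update-off c₀ u≢v)
      where
      u≢v : u ≢ v
      u≢v refl with () ← trans (sym Sv) Su
    colour-v : c v ≡ x
    colour-v = trans (c-agrees v removed) (update-at c₀ v x)
    from-v : ΣOn (∁ S) (monochromatic c v) ≡ ΣOn (∁ S) (λ w → indicator (adj G v w ∧ does (x ≟ᵇ c₀ w)))
    from-v = ΣOn-cong (∁ S) (λ w ∁Sw → cong₂ (λ p q → indicator (adj G v w ∧ does (p ≟ᵇ q)))
                                   colour-v (agrees w (trans (sym (not-involutive (S w))) (cong not ∁Sw))))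
    half : 2 * Meeting (monochromatic c) S ≤ Meeting edge S
    half = begin
      2 * Meeting (monochromatic c) S
        ≡⟨ cong (2 *_) (Meeting-remove (monochromatic c) (monochromatic-sym c) (monochromatic-diag c) S v Sv) ⟩
      2 * (Meeting (monochromatic c) (S ─ v) + 2 * ΣOn (∁ S) (monochromatic c v))
        ≡⟨ *-distribˡ-+ 2 (Meeting (monochromatic c) (S ─ v)) _ ⟩
      2 * Meeting (monochromatic c) (S ─ v) + 2 * (2 * ΣOn (∁ S) (monochromatic c v))
        ≤⟨ +-mono-≤ c-half (*-monoʳ-≤ 2 (≤-trans (≤-reflexive (cong (2 *_) from-v)) x-rare)) ⟩
      Meeting edge (S ─ v) + 2 * ΣOn (∁ S) (edge v)
        ≡⟨ sym (Meeting-remove edge edge-sym edge-diag S v Sv) ⟩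
      Meeting edge S ∎
      where open ≤-Reasoning

  recolour-bounded : ∀ m S → count S ≤ m → ∀ c₀ → HalfRecolouring S c₀
  recolour-bounded m S |S|≤m c₀ with any? (λ u → S u ≟ᵇ true)
  ... | no no-member = c₀ , (λ _ _ → refl) ,
          subst (λ k → 2 * k ≤ Meeting edge S) (sym (Meeting-empty _ S empty)) z≤n
    where
    empty : ∀ u → S u ≡ false
    empty u = ¬-not (λ Su → no-member (u , Su))
  recolour-bounded zero    S |S|≤0 c₀ | yes (v , Sv) =
    ⊥-elim (n≮0 (subst (_≤ 0) (Removal.count-remove S v Sv) |S|≤0))
  recolour-bounded (suc m) S |S|≤m c₀ | yes (v , Sv) =
    recolour-step S v Sv
      (recolour-bounded m (S ─ v) (≤-pred (subst (_≤ suc m) (Removal.count-remove S v Sv) |S|≤m))) c₀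

  recolour : ∀ S c₀ → HalfRecolouring S c₀
  recolour S = recolour-bounded (count S) S ≤-refl

  monochromatic-edges : (Fin n → Bool) → EdgeSet G
  monochromatic-edges c = record
    { mem  = λ u w → adj G u w ∧ sameColour c u w
    ; msym = λ u w → cong₂ _∧_ (adj-sym G u w) (sameColour-sym c u w)
    ; sub  = λ u w → ∧-conicalˡ _ _
    }

  deleting-monochromatic : ∀ c → BipartiteAfterDeleting G (monochromatic-edges c)
  deleting-monochromatic c = c , λ u w uw not-mono same →
    true≢false (trans (sym (cong₂ _∧_ uw (dec-true (c u ≟ᵇ c w) same))) not-mono)

  monochromatic-edgeCount : ∀ c →
    2 * edgeCount (monochromatic-edges c) ≡ PairSum (monochromatic c) everything everything
  monochromatic-edgeCount c = handshake (mem (monochromatic-edges c)) (msym (monochromatic-edges c))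
    (λ u → cong (_∧ sameColour c u u) (irrefl G u))

  proper-no-monochromatic : ∀ c X → ProperOn c X → PairSum (monochromatic c) X X ≡ 0
  proper-no-monochromatic c X proper =
    ΣOn-zero X _ (λ u Xu → ΣOn-zero X _ (λ w Xw → no-pair u w Xu Xw))
    where
    no-pair : ∀ u w → X u ≡ true → X w ≡ true → monochromatic c u w ≡ 0
    no-pair u w Xu Xw with adj G u w in uw
    ... | false = refl
    ... | true  = cong indicator (dec-false (c u ≟ᵇ c w) (proper u w Xu Xw uw))

  -- If c is proper on G[∁ S], every monochromatic edge meets S, so twice
  -- their number is Meeting (monochromatic c) S.
  monochromatic-edges-meet : ∀ c S → ProperOn c (∁ S) →
    2 * edgeCount (monochromatic-edges c) ≡ Meeting (monochromatic c) S
  monochromatic-edges-meet c S proper = begin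
    2 * edgeCount (monochromatic-edges c)
      ≡⟨ monochromatic-edgeCount c ⟩
    PairSum (monochromatic c) everything everything
      ≡⟨ PairSum-everything (monochromatic c) (monochromatic-sym c) S ⟩
    Meeting (monochromatic c) S + PairSum (monochromatic c) (∁ S) (∁ S)
      ≡⟨ cong (Meeting (monochromatic c) S +_) (proper-no-monochromatic c (∁ S) proper) ⟩
    Meeting (monochromatic c) S + 0
      ≡⟨ +-identityʳ _ ⟩
    Meeting (monochromatic c) S ∎
    where open ≡-Reasoning

  edges≤product : ∀ X Y → PairSum edge X Y ≤ count X * count Y
  edges≤product X Y = begin
    PairSum edge X Y            ≤⟨ ΣOn-mono X (λ u _ → ΣOn-mono Y (λ w _ → edge≤1 u w)) ⟩
    ΣOn X (λ _ → ΣOn Y (λ _ → 1)) ≡⟨ ΣOn-const X _ ⟩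
    count X * ΣOn Y (λ _ → 1)   ≡⟨ cong (count X *_) (sym (count-as-ΣOn Y)) ⟩
    count X * count Y           ∎
    where open ≤-Reasoning

final-arithmetic : ∀ f m x i r b → 2 * f ≡ m → 2 * m ≤ 2 * x + i → x ≤ r * b → 4 * i ≤ 3 * (r * r) →
  16 * f ≤ 8 * (b * r) + 3 * (r * r)
final-arithmetic f m x i r b 2f≡m 2m≤ x≤rb 4i≤ = begin
  16 * f               ≡⟨ solve 1 (λ f → con 16 :* f := con 4 :* (con 2 :* (con 2 :* f))) refl f ⟩
  4 * (2 * (2 * f))    ≡⟨ cong (λ y → 4 * (2 * y)) 2f≡m ⟩
  4 * (2 * m)          ≤⟨ *-monoʳ-≤ 4 2m≤ ⟩
  4 * (2 * x + i)      ≡⟨ solve 2 (λ x i → con 4 :* (con 2 :* x :+ i) := con 8 :* x :+ con 4 :* i) refl x i ⟩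
  8 * x + 4 * i        ≤⟨ +-mono-≤ (*-monoʳ-≤ 8 (≤-trans x≤rb (≤-reflexive (*-comm r b)))) 4i≤ ⟩
  8 * (b * r) + 3 * (r * r) ∎
  where open ≤-Reasoning

lemma3p3 : (n : ℕ) (G : Graph n) → K5Free G →
    (b : ℕ) →
    (∃ λ (B : Fin n → Bool) → InducedBipartite G B × count B ≡ b) →
    (∀ (B : Fin n → Bool) → InducedBipartite G B → count B ≤ b) →
    ∃ λ (F : EdgeSet G) → BipartiteAfterDeleting G F ×
      16 * edgeCount F ≤ 8 * (b * (n ∸ b)) + 3 * ((n ∸ b) * (n ∸ b))
lemma3p3 n G k5-free b (B , (c₀ , c₀-proper) , |B|≡b) _ with recolour G (∁ B) c₀
... | c , c-agrees , c-half =
  F , deleting-monochromatic G c ,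
  subst (λ r → 16 * edgeCount F ≤ 8 * (b * r) + 3 * (r * r)) |R|≡n∸b
    (final-arithmetic (edgeCount F) _ _ _ (count R) b
      (monochromatic-edges-meet G c R c-proper-off-R) c-half
      (subst (PairSum (edge G) R (∁ R) ≤_) (cong (count R *_) |∁R|≡b) (edges≤product G R (∁ R)))
      (turán G 3 R (no-clique₅ G k5-free R)))
  where
  R = ∁ B
  F = monochromatic-edges G c
  -- outside R lies B, where c agrees with the proper colouring c₀
  c-proper-off-R : ProperOn G c (∁ R)
  c-proper-off-R u w u∉R w∉R uw same =
    c₀-proper u w (in-B u∉R) (in-B w∉R) uw (trans (sym (on-B u∉R)) (trans same (on-B w∉R)))
    where
    in-B : ∀ {u} → ∁ R u ≡ true → B u ≡ true
    in-B {u} = trans (sym (not-involutive (B u)))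
    on-B : ∀ {u} → ∁ R u ≡ true → c u ≡ c₀ u
    on-B {u} u∉R = c-agrees u (cong not (in-B u∉R))
  |∁R|≡b : count (∁ R) ≡ b
  |∁R|≡b = trans (count-∁∁ B) |B|≡b
  |R|≡n∸b : count R ≡ n ∸ b
  |R|≡n∸b = begin
    count R                        ≡⟨ sym (m+n∸m≡n (count B) (count R)) ⟩
    (count B + count R) ∸ count B  ≡⟨ cong₂ _∸_ (count-complement B) |B|≡b ⟩
    n ∸ b                          ∎
    where open ≡-Reasoning
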